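{- For any non-empty hypersequent $\mathcal{G}$, $\mathcal{G}$ is valid in the variety $\mathcal{A}$ of abelian $\ell$-groups if and only if $\mathcal{G}$ is derivable in the hypersequent calculus $\mathrm{GA}$.
   Context: A literal is a variable $x$ or its inverse $x^{ -1}$; set $\overline{x}=x^{ -1}$ and $\overline{x^{ -1}}=x$. A sequent $\Gamma$ is a finite sequence of literals $\ell_1,\ldots,\ell_n$, with inverse $\overline{\Gamma}=\overline{\ell_n},\ldots,\overline{\ell_1}$; it is identified with the group term $\ell_1\cdots\ell_n$ (and with $e$ if $n=0$). A hypersequent is a finite set of sequents, written $\Gamma_1\mid\ldots\mid\Gamma_n$; a non-empty hypersequent is identified with the $\ell$-group term $\Gamma_1\lor\dots\lor\Gamma_n$. A non-empty hypersequent $\mathcal{G}$ is valid in a class $\mathcal{K}$ of $\ell$-groups if $e \le \mathcal{G}$ holds in every member of $\mathcal{K}$ under every assignment. An $\ell$-group is an algebra $\langle L,\land,\lor,\cdot,{}^{ -1},e\rangle$ that is a group and a lattice with $a\le b \Rightarrow cad\le cbd$; abelian if $\cdot$ is commutative. Below $\mathcal{G}\mid\Gamma$ denotes $\mathcal{G}\cup\{\Gamma\}$ for an arbitrary (possibly empty) hypersequent $\mathcal{G}$, and $\Gamma,\Delta$ denotes concatenation. The calculus $\mathrm{GA}$ has the rules: (id) with no premises and conclusion $\mathcal{G}\mid\Delta,\overline{\Delta}$; (ex) from $\mathcal{G}\mid\Pi,\Delta,\Gamma$ infer $\mathcal{G}\mid\Pi,\Gamma,\Delta$; (split) from $\mathcal{G}\mid\Gamma,\Delta$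 infer $\mathcal{G}\mid\Gamma\mid\Delta$. A derivation of $\mathcal{G}$ is a finite tree of hypersequents with root $\mathcal{G}$ in which each node together with its parents (premises) forms an instance of a rule. -}

module Defs where

open import Level using (Level; _⊔_; Setω) renaming (suc to lsuc)
open import Data.Nat using (ℕ)
open import Data.List using (List; []; _∷_; _++_; reverse; map; foldr)
open import Data.List.Relation.Binary.BagAndSetEquality using (_∼[_]_; set)
open import Algebra.Core using (Op₁; Op₂)
open import Algebra.Structures using (IsAbelianGroup)
open import Algebra.Lattice.Structures using (IsLattice)
open import Relation.Binary.Core using (Rel)

Var : Set
Var = ℕ

-- A literal is a variable x or its inverse x⁻¹.
data Literal : Set where
  pos : Var → Literal
  neg : Var → Literal

inv : Literal → Literal
inv (pos x) = neg x
inv (neg x) = pos x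

Sequent : Set
Sequent = List Literal

invSeq : Sequent → Sequent
invSeq Γ = reverse (map inv Γ)

-- A hypersequent is a finite SET of sequents; represented by a list,
-- with all rules working up to set equality (same members).
Hypersequent : Set
Hypersequent = List Sequent

_≋_ : Hypersequent → Hypersequent → Set
H ≋ K = H ∼[ set ] K

-- The calculus GA.  Each constructor: the conclusion H is (as a set)
-- the displayed conclusion of the rule; the premise is given by a
-- list representing the displayed premise set.
data GA⊢ : Hypersequent → Set where
  id    : ∀ {H} (G : Hypersequent) (Δ : Sequent) →
          H ≋ ((Δ ++ invSeq Δ) ∷ G) → GA⊢ H
  ex    : ∀ {H} (G : Hypersequent) (Π Δ Γ : Sequent) →
          H ≋ ((Π ++ Γ ++ Δ) ∷ G) →
          GA⊢ ((Π ++ Δ ++ Γ) ∷ G) → GA⊢ H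
  split : ∀ {H} (G : Hypersequent) (Γ Δ : Sequent) →
          H ≋ (Γ ∷ Δ ∷ G) →
          GA⊢ ((Γ ++ Δ) ∷ G) → GA⊢ H

record AbelianLGroup (c ℓ : Level) : Set (lsuc (c ⊔ ℓ)) where
  infixl 7 _∙_
  infixr 6 _∨_
  infixr 7 _∧_
  infix 4 _≈_
  field
    Carrier : Set c
    _≈_     : Rel Carrier ℓ
    _∙_     : Op₂ Carrier
    ε       : Carrier
    _⁻¹     : Op₁ Carrier
    _∨_     : Op₂ Carrier
    _∧_     : Op₂ Carrier
    isAbelianGroup : IsAbelianGroup _≈_ _∙_ ε _⁻¹
    isLattice      : IsLattice _≈_ _∨_ _∧_
    monotone : ∀ {a b} (x y : Carrier) → a ∧ b ≈ a →
               ((x ∙ a) ∙ y) ∧ ((x ∙ b) ∙ y) ≈ (x ∙ a) ∙ y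

  _≤_ : Carrier → Carrier → Set ℓ
  a ≤ b = a ∧ b ≈ a

module _ {c ℓ : Level} (L : AbelianLGroup c ℓ) where
  open AbelianLGroup L

  ⟦_⟧ℓ : Literal → (Var → Carrier) → Carrier
  ⟦ pos x ⟧ℓ ρ = ρ x
  ⟦ neg x ⟧ℓ ρ = (ρ x) ⁻¹

  ⟦_⟧s : Sequent → (Var → Carrier) → Carrier
  ⟦ [] ⟧s ρ = ε
  ⟦ l ∷ [] ⟧s ρ = ⟦ l ⟧ℓ ρ
  ⟦ l ∷ Γ@(_ ∷ _) ⟧s ρ = ⟦ l ⟧ℓ ρ ∙ ⟦ Γ ⟧s ρ

  ⟦_∷_⟧h : Sequent → Hypersequent → (Var → Carrier) → Carrier
  ⟦ Γ ∷ [] ⟧h ρ = ⟦ Γ ⟧s ρ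
  ⟦ Γ ∷ (Δ ∷ Gs) ⟧h ρ = ⟦ Γ ⟧s ρ ∨ ⟦ Δ ∷ Gs ⟧h ρ

  ValidIn : Sequent → Hypersequent → Set (c ⊔ ℓ)
  ValidIn Γ Gs = ∀ (ρ : Var → Carrier) → ε ≤ ⟦ Γ ∷ Gs ⟧h ρ

Valid𝒜 : Sequent → Hypersequent → Setω
Valid𝒜 Γ Gs = ∀ {c ℓ} (L : AbelianLGroup c ℓ) → ValidIn L Γ Gs

record _⇔ω_ (A : Setω) (B : Set) : Setω where
  field
    to   : A → B
    from : B → A

-- Soundness holds rule by rule; the only non-trivial rule is (split), which rests on
-- ε ≤ u (u ∨ ε) ⇒ ε ≤ u in every abelian ℓ-group.
-- Completeness only uses validity in ℚ: no rational assignment makes all sequents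
-- negative.  Variables are eliminated one at a time, Fourier–Motzkin style: sequents
-- balanced in x are kept, and each sequent Γ with a surplus a + 1 of x is combined with
-- each sequent Δ with a deficit b + 1 into Γ^(b+1) Δ^(a+1).  A refutation of the new
-- hypersequent extends to one of the old by choosing for x a value between the bounds
-- that the old sequents impose, and GA recovers the old hypersequent from the new one
-- by (split) and contraction.  Once no variable is left every sequent is balanced,
-- hence a permutation of Δ, Δ̄, derivable by (id) and (ex).

module Submission where

open import Defs
open import Level using (Level; 0ℓ)
open import Algebra.Properties.Group using (∙-cancelʳ)
import Algebra.Properties.AbelianGroup as AbelianGroupProperties
open import Algebra.Bundles using (AbelianGroup)
open import Algebra.Structures using (IsAbelianGroup)
open import Algebra.Lattice.Bundles using (Lattice)
open import Algebra.Lattice.Structures using (IsLattice)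
import Algebra.Lattice.Properties.Lattice as LatticeProperties
open import Data.Bool.Base using (if_then_else_)
open import Data.Empty using (⊥-elim)
open import Data.List.Base using (List; []; _∷_; _++_; [_]; map; length; concatMap)
open import Data.List.Properties using (++-assoc; ++-identityʳ; reverse-++; length-++)
open import Data.List.Membership.Propositional using (_∈_; find; lose)
open import Data.List.Membership.Propositional.Properties
  using (∈-∃++; ∈-++⁺ˡ; ∈-++⁺ʳ; ∈-++⁻; ∈-concatMap⁺; ∈-concatMap⁻)
open import Data.List.Relation.Unary.All as All using (All; []; _∷_)
open import Data.List.Relation.Unary.All.Properties using (concat⁺; map⁺)
open import Data.List.Relation.Unary.Any using (here; there)
open import Data.List.Relation.Binary.BagAndSetEquality using (++-cong)
open import Data.List.Relation.Binary.Permutation.Propositional as ↭ using (_↭_)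
open import Data.List.Relation.Binary.Permutation.Propositional.Properties using (shift; ∷↭∷ʳ; ++⁺ʳ)
open import Data.Nat.Base as ℕ using (ℕ; zero; suc; s≤s)
import Data.Nat.Properties as ℕₚ
open import Data.Nat.Solver renaming (module +-*-Solver to ℕ-Solver)
open import Data.Product.Base using (∃; _×_; _,_)
open import Data.Rational.Base
  using (ℚ; 0ℚ; 1ℚ; _+_; _*_; -_; _-_; 1/_; _÷_; _<_; _≤_; Positive; NonNegative; NonZero; positive)
open import Data.Rational.Properties
  using (+-0-isAbelianGroup; ⊔-⊓-isLattice; +-0-group; p≤q⇒p⊓q≡p; p⊓q≡p⇒p≤q; ⊔-sel;
         +-assoc; +-identityˡ; +-identityʳ; +-inverseʳ; *-identityʳ; *-inverseʳ; *-zeroˡ;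
         +-mono-≤; +-monoˡ-≤; +-monoʳ-≤; +-monoʳ-<; +-monoˡ-<; +-mono-<-≤; *-monoʳ-<-pos; *-cancelˡ-<-nonNeg;
         <-dense; _<?_; ≮⇒≥; <-irrefl; <-trans; <-≤-trans; ≤-<-trans; ≤-refl; <⇒≤;
         positive⁻¹; negative⁻¹; pos⇒nonZero; pos⇒nonNeg; pos*pos⇒pos; module ≤-Reasoning)
open import Data.Rational.Solver renaming (module +-*-Solver to ℚ-Solver)
open import Data.Sum.Base using (inj₁; inj₂)
open import Function.Base using (_∘_)
open import Function.Bundles using (Equivalence; mk⇔)
open import Function.Related.Propositional using (K-refl; SK-sym; K-trans)
import Relation.Binary.Lattice as OrderLattice
import Relation.Binary.Reasoning.PartialOrder as ≼-Reasoning
open import Relation.Binary.Definitions using (DecidableEquality)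
open import Relation.Binary.PropositionalEquality
  using (_≡_; _≢_; refl; sym; trans; cong; cong₂; subst; ≡-≟-identity; ≢-≟-identity; module ≡-Reasoning)
open import Relation.Nullary.Decidable using (does; yes; no; map′)
open import Relation.Nullary.Negation using (¬_)

≋-refl : ∀ {H} → H ≋ H
≋-refl = K-refl

GA-resp-≋ : ∀ {H K} → H ≋ K → GA⊢ H → GA⊢ K
GA-resp-≋ H≋K (id G Δ e)          = id G Δ (K-trans (SK-sym H≋K) e)
GA-resp-≋ H≋K (ex G Π Δ Γ e d)    = ex G Π Δ Γ (K-trans (SK-sym H≋K) e) d
GA-resp-≋ H≋K (split G Γ Δ e d)   = split G Γ Δ (K-trans (SK-sym H≋K) e) d

GA-resp-≡ : ∀ {Γ Δ G} → Γ ≡ Δ → GA⊢ (Γ ∷ G) → GA⊢ (Δ ∷ G)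
GA-resp-≡ {G = G} = subst (λ Σ → GA⊢ (Σ ∷ G))

GA-weaken : ∀ {H} K → GA⊢ H → GA⊢ (H ++ K)
GA-weaken K (id G Δ e)        = id (G ++ K) Δ (++-cong e K-refl)
GA-weaken K (ex G Π Δ Γ e d)  = ex (G ++ K) Π Δ Γ (++-cong e K-refl) (GA-weaken K d)
GA-weaken K (split G Γ Δ e d) = split (G ++ K) Γ Δ (++-cong e K-refl) (GA-weaken K d)

GA-contract : ∀ {Γ K} → Γ ∈ K → GA⊢ (Γ ∷ K) → GA⊢ K
GA-contract {Γ} {K} Γ∈K = GA-resp-≋ (mk⇔ absorb there)
  where
  absorb : ∀ {Δ} → Δ ∈ Γ ∷ K → Δ ∈ K
  absorb (here refl) = Γ∈K
  absorb (there Δ∈K) = Δ∈K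

GA-absorb : ∀ {Γ Δ K} → Γ ∈ K → GA⊢ ((Γ ++ Δ) ∷ K) → GA⊢ (Δ ∷ K)
GA-absorb {Γ} {Δ} {K} Γ∈K = split K Γ Δ (mk⇔ there absorb)
  where
  absorb : ∀ {Σ} → Σ ∈ Γ ∷ Δ ∷ K → Σ ∈ Δ ∷ K
  absorb (here refl) = there Γ∈K
  absorb (there Σ∈ΔK) = Σ∈ΔK

infixl 8 _^_
_^_ : Sequent → ℕ → Sequent
Γ ^ zero  = []
Γ ^ suc n = Γ ++ Γ ^ n

GA-absorb-^ : ∀ {Γ Δ K} n → Γ ∈ K → GA⊢ ((Γ ^ n ++ Δ) ∷ K) → GA⊢ (Δ ∷ K)
GA-absorb-^ zero    Γ∈K d = d
GA-absorb-^ {Γ} {Δ} (suc n) Γ∈K d = GA-absorb-^ n Γ∈K (GA-absorb Γ∈K (GA-resp-≡ (++-assoc Γ (Γ ^ n) Δ) d))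

GA-absorb-^-suc : ∀ {Γ K} n → Γ ∈ K → GA⊢ (Γ ^ suc n ∷ K) → GA⊢ K
GA-absorb-^-suc {Γ} zero    Γ∈K d = GA-contract Γ∈K (GA-resp-≡ (++-identityʳ Γ) d)
GA-absorb-^-suc     (suc n) Γ∈K d = GA-absorb-^-suc n Γ∈K (GA-absorb Γ∈K d)

GA-swap : ∀ {G} Π x y Σ → GA⊢ ((Π ++ y ∷ x ∷ Σ) ∷ G) → GA⊢ ((Π ++ x ∷ y ∷ Σ) ∷ G)
GA-swap {G} Π x y Σ d = ex G Π (y ∷ Σ) [ x ] ≋-refl (GA-resp-≡ (++-assoc Π [ y ] (Σ ++ [ x ])) d′)
  where
  d′ : GA⊢ (((Π ++ [ y ]) ++ Σ ++ [ x ]) ∷ G)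
  d′ = ex G (Π ++ [ y ]) [ x ] Σ ≋-refl (GA-resp-≡ (sym (++-assoc Π [ y ] (x ∷ Σ))) d)

GA-↭ : ∀ {G} Π {Σ Φ} → Σ ↭ Φ → GA⊢ ((Π ++ Φ) ∷ G) → GA⊢ ((Π ++ Σ) ∷ G)
GA-↭ Π ↭.refl d = d
GA-↭ Π (↭.prep x p) d =
  GA-resp-≡ (++-assoc Π [ x ] _) (GA-↭ (Π ++ [ x ]) p (GA-resp-≡ (sym (++-assoc Π [ x ] _)) d))
GA-↭ Π (↭.swap {xs} {ys} x y p) d =
  GA-swap Π x y xs (GA-resp-≡ (++-assoc Π (y ∷ x ∷ []) xs)
    (GA-↭ (Π ++ y ∷ x ∷ []) p (GA-resp-≡ (sym (++-assoc Π (y ∷ x ∷ []) ys)) d)))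
GA-↭ Π (↭.trans p q) d = GA-↭ Π p (GA-↭ Π q d)

pos-injective : ∀ {x y} → pos x ≡ pos y → x ≡ y
pos-injective refl = refl

neg-injective : ∀ {x y} → neg x ≡ neg y → x ≡ y
neg-injective refl = refl

_≟ˡ_ : DecidableEquality Literal
pos x ≟ˡ pos y = map′ (cong pos) pos-injective (x ℕₚ.≟ y)
neg x ≟ˡ neg y = map′ (cong neg) neg-injective (x ℕₚ.≟ y)
pos x ≟ˡ neg y = no λ ()
neg x ≟ˡ pos y = no λ ()

δ : Literal → Literal → ℕ
δ l m = if does (l ≟ˡ m) then 1 else 0

count : Literal → Sequent → ℕ
count l []      = 0
count l (m ∷ Γ) = δ l m ℕ.+ count l Γ

δ-refl : ∀ l → δ l l ≡ 1
δ-refl l rewrite ≡-≟-identity _≟ˡ_ {l} refl = refl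

δ-≢ : ∀ {l m} → l ≢ m → δ l m ≡ 0
δ-≢ l≢m rewrite ≢-≟-identity _≟ˡ_ l≢m = refl

inv-involutive : ∀ l → inv (inv l) ≡ l
inv-involutive (pos x) = refl
inv-involutive (neg x) = refl

δ-inv : ∀ l m → δ (inv l) (inv m) ≡ δ l m
δ-inv (pos x) (pos y) = refl
δ-inv (pos x) (neg y) = refl
δ-inv (neg x) (pos y) = refl
δ-inv (neg x) (neg y) = refl

count-++ : ∀ l Γ Δ → count l (Γ ++ Δ) ≡ count l Γ ℕ.+ count l Δ
count-++ l []      Δ = refl
count-++ l (m ∷ Γ) Δ rewrite count-++ l Γ Δ = sym (ℕₚ.+-assoc (δ l m) _ _)

count-^ : ∀ l Γ n → count l (Γ ^ n) ≡ n ℕ.* count l Γ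
count-^ l Γ zero    = refl
count-^ l Γ (suc n) rewrite count-++ l Γ (Γ ^ n) | count-^ l Γ n = refl

count≡suc⇒∈ : ∀ {l n} Γ → count l Γ ≡ suc n → l ∈ Γ
count≡suc⇒∈ {l} (m ∷ Γ) eq with l ≟ˡ m
... | yes refl = here refl
... | no _     = there (count≡suc⇒∈ Γ eq)

BalancedIn : Var → Sequent → Set
BalancedIn y Γ = count (pos y) Γ ≡ count (neg y) Γ

Balanced : Sequent → Set
Balanced Γ = ∀ y → BalancedIn y Γ

inv∈-balanced : ∀ l Γ → Balanced (l ∷ Γ) → inv l ∈ Γ
inv∈-balanced (pos y) Γ bal =
  count≡suc⇒∈ Γ (sym (trans (cong (ℕ._+ count (pos y) Γ) (sym (δ-refl (pos y)))) (bal y)))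
inv∈-balanced (neg y) Γ bal =
  count≡suc⇒∈ Γ (trans (bal y) (cong (ℕ._+ count (neg y) Γ) (δ-refl (neg y))))

balanced-remove-pair : ∀ l Γ Δ → Balanced (l ∷ Γ ++ inv l ∷ Δ) → Balanced (Γ ++ Δ)
balanced-remove-pair l Γ Δ bal y =
  ℕₚ.+-cancelˡ-≡ (δ (pos y) l ℕ.+ δ (pos y) (inv l)) _ _ (begin
    δ (pos y) l ℕ.+ δ (pos y) (inv l) ℕ.+ count (pos y) (Γ ++ Δ) ≡⟨ spread (pos y) ⟨
    count (pos y) (l ∷ Γ ++ inv l ∷ Δ)                         ≡⟨ bal y ⟩
    count (neg y) (l ∷ Γ ++ inv l ∷ Δ)                         ≡⟨ spread (neg y) ⟩
    δ (neg y) l ℕ.+ δ (neg y) (inv l) ℕ.+ count (neg y) (Γ ++ Δ) ≡⟨ cong (ℕ._+ count (neg y) (Γ ++ Δ)) pair-balanced ⟩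
    δ (pos y) l ℕ.+ δ (pos y) (inv l) ℕ.+ count (neg y) (Γ ++ Δ) ∎)
  where
  open ≡-Reasoning
  open ℕ-Solver using (solve; _:+_; _:=_)
  spread : ∀ m → count m (l ∷ Γ ++ inv l ∷ Δ) ≡ δ m l ℕ.+ δ m (inv l) ℕ.+ count m (Γ ++ Δ)
  spread m rewrite count-++ m Γ (inv l ∷ Δ) | count-++ m Γ Δ =
    solve 4 (λ a b c d → a :+ (c :+ (b :+ d)) := (a :+ b) :+ (c :+ d)) refl
      (δ m l) (δ m (inv l)) (count m Γ) (count m Δ)
  pair-balanced : δ (neg y) l ℕ.+ δ (neg y) (inv l) ≡ δ (pos y) l ℕ.+ δ (pos y) (inv l)
  pair-balanced =
    trans (cong₂ ℕ._+_ swapped (δ-inv (pos y) l)) (ℕₚ.+-comm (δ (pos y) (inv l)) (δ (pos y) l))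
    where
    swapped : δ (neg y) l ≡ δ (pos y) (inv l)
    swapped = trans (cong (δ (neg y)) (sym (inv-involutive l))) (δ-inv (pos y) (inv l))

invSeq-∷ : ∀ l Δ → invSeq (l ∷ Δ) ≡ invSeq Δ ++ [ inv l ]
invSeq-∷ l Δ = reverse-++ [ inv l ] (map inv Δ)

balanced⇒↭ : ∀ n Γ → length Γ ℕ.≤ n → Balanced Γ → ∃ λ Δ → Γ ↭ Δ ++ invSeq Δ
balanced⇒↭ _       []      _         _   = [] , ↭.refl
balanced⇒↭ (suc n) (l ∷ Γ) (s≤s len) bal with ∈-∃++ (inv∈-balanced l Γ bal)
... | Φ , Ψ , refl with balanced⇒↭ n (Φ ++ Ψ) shorter (balanced-remove-pair l Φ Ψ bal)
  where
  shorter : length (Φ ++ Ψ) ℕ.≤ n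
  shorter rewrite length-++ Φ {Ψ} | length-++ Φ {inv l ∷ Ψ} =
    ℕₚ.≤-trans (ℕₚ.+-monoʳ-≤ (length Φ) (ℕₚ.n≤1+n (length Ψ))) len
... | Δ , p = l ∷ Δ , ↭.prep l (begin
    Φ ++ inv l ∷ Ψ                ↭⟨ shift (inv l) Φ Ψ ⟩
    inv l ∷ Φ ++ Ψ                ↭⟨ ∷↭∷ʳ (inv l) (Φ ++ Ψ) ⟩
    (Φ ++ Ψ) ++ [ inv l ]         ↭⟨ ++⁺ʳ [ inv l ] p ⟩
    (Δ ++ invSeq Δ) ++ [ inv l ]  ≡⟨ ++-assoc Δ (invSeq Δ) [ inv l ] ⟩
    Δ ++ invSeq Δ ++ [ inv l ]    ≡⟨ cong (Δ ++_) (invSeq-∷ l Δ) ⟨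
    Δ ++ invSeq (l ∷ Δ)           ∎)
  where open ↭.PermutationReasoning

GA-balanced : ∀ {G Γ} → Balanced Γ → GA⊢ (Γ ∷ G)
GA-balanced {G} {Γ} bal with balanced⇒↭ (length Γ) Γ ℕₚ.≤-refl bal
... | Δ , p = GA-↭ [] p (id G Δ ≋-refl)

module Soundness {c ℓ : Level} (L : AbelianLGroup c ℓ) where

  open AbelianLGroup L renaming (_≤_ to _≤ᴸ_)
  open IsAbelianGroup isAbelianGroup
    using (assoc; comm; identityˡ; identityʳ; inverseˡ; inverseʳ; ∙-cong; ∙-congˡ; ∙-congʳ; ⁻¹-cong)
    renaming (refl to ≈-refl; sym to ≈-sym; trans to ≈-trans)
  open IsLattice isLattice using (∧-cong)

  abelianGroup : AbelianGroup c ℓ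
  abelianGroup = record { isAbelianGroup = isAbelianGroup }

  open AbelianGroupProperties abelianGroup using (⁻¹-∙-comm; ⁻¹-involutive)

  lattice : Lattice c ℓ
  lattice = record { isLattice = isLattice }

  open OrderLattice.Lattice (LatticeProperties.∨-∧-orderTheoreticLattice lattice)
    using (poset; x≤x∨y; y≤x∨y; ∨-least)
    renaming (_≤_ to _≼_; trans to ≼-trans; reflexive to ≼-reflexive)
  open ≼-Reasoning poset

  ≼⇒≤ : ∀ {a b} → a ≼ b → a ≤ᴸ b
  ≼⇒≤ = ≈-sym

  x⁻¹∙[x∙y]≈y : ∀ x y → x ⁻¹ ∙ (x ∙ y) ≈ y
  x⁻¹∙[x∙y]≈y x y = ≈-trans (≈-sym (assoc _ _ _)) (≈-trans (∙-congʳ (inverseˡ x)) (identityˡ y))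

  ∙-monoʳ-≼ : ∀ x {a b} → a ≼ b → x ∙ a ≼ x ∙ b
  ∙-monoʳ-≼ x a≼b = ≈-sym (≈-trans (∧-cong (≈-sym (identityʳ _)) (≈-sym (identityʳ _)))
                                    (≈-trans (monotone x ε (≈-sym a≼b)) (identityʳ _)))

  ∙-monoˡ-≼ : ∀ x {a b} → a ≼ b → a ∙ x ≼ b ∙ x
  ∙-monoˡ-≼ x {a} {b} a≼b = begin
    a ∙ x ≈⟨ comm a x ⟩
    x ∙ a ≤⟨ ∙-monoʳ-≼ x a≼b ⟩
    x ∙ b ≈⟨ comm x b ⟩
    b ∙ x ∎

  ∙-mono-≼ : ∀ {a b a′ b′} → a ≼ b → a′ ≼ b′ → a ∙ a′ ≼ b ∙ b′
  ∙-mono-≼ {a} {b} {a′} {b′} a≼b a′≼b′ = begin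
    a ∙ a′ ≤⟨ ∙-monoˡ-≼ a′ a≼b ⟩
    b ∙ a′ ≤⟨ ∙-monoʳ-≼ b a′≼b′ ⟩
    b ∙ b′ ∎

  ∙-cancelˡ-≼ : ∀ x {a b} → x ∙ a ≼ x ∙ b → a ≼ b
  ∙-cancelˡ-≼ x {a} {b} xa≼xb = begin
    a                ≈⟨ x⁻¹∙[x∙y]≈y x a ⟨
    x ⁻¹ ∙ (x ∙ a)   ≤⟨ ∙-monoʳ-≼ (x ⁻¹) xa≼xb ⟩
    x ⁻¹ ∙ (x ∙ b)   ≈⟨ x⁻¹∙[x∙y]≈y x b ⟩
    b                ∎

  -- With p = u ∨ ε and n = u⁻¹ ∨ ε, the hypothesis gives n ≼ p, and always p ≼ n ∙ u;
  -- cancelling n in n ∙ ε ≼ n ∙ u leaves ε ≼ u.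
  ε≼u∙[u∨ε]⇒ε≼u : ∀ u → ε ≼ u ∙ (u ∨ ε) → ε ≼ u
  ε≼u∙[u∨ε]⇒ε≼u u hyp = ∙-cancelˡ-≼ n (begin
    n ∙ ε  ≈⟨ identityʳ n ⟩
    n      ≤⟨ ∨-least u⁻¹≼p (y≤x∨y u ε) ⟩
    u ∨ ε  ≤⟨ ∨-least u≼n∙u ε≼n∙u ⟩
    n ∙ u  ∎)
    where
    n : Carrier
    n = u ⁻¹ ∨ ε
    u⁻¹≼p : u ⁻¹ ≼ u ∨ ε
    u⁻¹≼p = begin
      u ⁻¹                   ≈⟨ identityʳ (u ⁻¹) ⟨
      u ⁻¹ ∙ ε               ≤⟨ ∙-monoʳ-≼ (u ⁻¹) hyp ⟩
      u ⁻¹ ∙ (u ∙ (u ∨ ε))   ≈⟨ x⁻¹∙[x∙y]≈y u (u ∨ ε) ⟩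
      u ∨ ε                  ∎
    u≼n∙u : u ≼ n ∙ u
    u≼n∙u = begin
      u      ≈⟨ identityˡ u ⟨
      ε ∙ u  ≤⟨ ∙-monoˡ-≼ u (y≤x∨y (u ⁻¹) ε) ⟩
      n ∙ u  ∎
    ε≼n∙u : ε ≼ n ∙ u
    ε≼n∙u = begin
      ε         ≈⟨ inverseˡ u ⟨
      u ⁻¹ ∙ u  ≤⟨ ∙-monoˡ-≼ u (x≤x∨y (u ⁻¹) ε) ⟩
      n ∙ u     ∎

  eval : Sequent → (Var → Carrier) → Carrier
  eval []      ρ = ε
  eval (l ∷ Γ) ρ = ⟦_⟧ℓ L l ρ ∙ eval Γ ρ

  ⟦⟧s≈eval : ∀ Γ ρ → ⟦_⟧s L Γ ρ ≈ eval Γ ρ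
  ⟦⟧s≈eval []          ρ = ≈-refl
  ⟦⟧s≈eval (l ∷ [])    ρ = ≈-sym (identityʳ _)
  ⟦⟧s≈eval (l ∷ m ∷ Γ) ρ = ∙-congˡ (⟦⟧s≈eval (m ∷ Γ) ρ)

  eval-++ : ∀ Γ Δ ρ → eval (Γ ++ Δ) ρ ≈ eval Γ ρ ∙ eval Δ ρ
  eval-++ []      Δ ρ = ≈-sym (identityˡ _)
  eval-++ (l ∷ Γ) Δ ρ = ≈-trans (∙-congˡ (eval-++ Γ Δ ρ)) (≈-sym (assoc _ _ _))

  eval-inv : ∀ l ρ → ⟦_⟧ℓ L (inv l) ρ ≈ ⟦_⟧ℓ L l ρ ⁻¹
  eval-inv (pos x) ρ = ≈-refl
  eval-inv (neg x) ρ = ≈-sym (⁻¹-involutive _)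

  eval-invSeq : ∀ Δ ρ → eval (invSeq Δ) ρ ≈ eval Δ ρ ⁻¹
  eval-invSeq []      ρ = ≈-sym (≈-trans (≈-sym (identityˡ (ε ⁻¹))) (inverseʳ ε))
  eval-invSeq (l ∷ Δ) ρ rewrite reverse-++ [ inv l ] (map inv Δ) = begin-equality
    eval (invSeq Δ ++ [ inv l ]) ρ              ≈⟨ eval-++ (invSeq Δ) [ inv l ] ρ ⟩
    eval (invSeq Δ) ρ ∙ (⟦_⟧ℓ L (inv l) ρ ∙ ε)  ≈⟨ ∙-cong (eval-invSeq Δ ρ) (≈-trans (identityʳ _) (eval-inv l ρ)) ⟩
    eval Δ ρ ⁻¹ ∙ ⟦_⟧ℓ L l ρ ⁻¹                ≈⟨ ⁻¹-∙-comm _ _ ⟩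
    (eval Δ ρ ∙ ⟦_⟧ℓ L l ρ) ⁻¹                 ≈⟨ ⁻¹-cong (comm _ _) ⟩
    (⟦_⟧ℓ L l ρ ∙ eval Δ ρ) ⁻¹                 ∎

  eval-id : ∀ Δ ρ → eval (Δ ++ invSeq Δ) ρ ≈ ε
  eval-id Δ ρ = ≈-trans (eval-++ Δ (invSeq Δ) ρ) (≈-trans (∙-congˡ (eval-invSeq Δ ρ)) (inverseʳ _))

  eval-ex : ∀ Π Γ Δ ρ → eval (Π ++ Γ ++ Δ) ρ ≈ eval (Π ++ Δ ++ Γ) ρ
  eval-ex Π Γ Δ ρ = begin-equality
    eval (Π ++ Γ ++ Δ) ρ             ≈⟨ eval-++ Π (Γ ++ Δ) ρ ⟩
    eval Π ρ ∙ eval (Γ ++ Δ) ρ       ≈⟨ ∙-congˡ (eval-++ Γ Δ ρ) ⟩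
    eval Π ρ ∙ (eval Γ ρ ∙ eval Δ ρ) ≈⟨ ∙-congˡ (comm _ _) ⟩
    eval Π ρ ∙ (eval Δ ρ ∙ eval Γ ρ) ≈⟨ ∙-congˡ (eval-++ Δ Γ ρ) ⟨
    eval Π ρ ∙ eval (Δ ++ Γ) ρ       ≈⟨ eval-++ Π (Δ ++ Γ) ρ ⟨
    eval (Π ++ Δ ++ Γ) ρ             ∎

  -- ε lies below every upper bound of the values of H; for non-empty H this says ε ≤ ⋁ H.
  ε≼⋁ : Hypersequent → (Var → Carrier) → Set _
  ε≼⋁ H ρ = ∀ u → (∀ {Γ} → Γ ∈ H → eval Γ ρ ≼ u) → ε ≼ u

  GA-sound : ∀ {H} → GA⊢ H → ∀ ρ → ε≼⋁ H ρ
  GA-sound (id G Δ e) ρ u H≼u = begin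
    ε                       ≈⟨ eval-id Δ ρ ⟨
    eval (Δ ++ invSeq Δ) ρ  ≤⟨ H≼u (Equivalence.from e (here refl)) ⟩
    u                       ∎
  GA-sound (ex G Π Δ Γ e d) ρ u H≼u = GA-sound d ρ u premise≼u
    where
    premise≼u : ∀ {Σ} → Σ ∈ (Π ++ Δ ++ Γ) ∷ G → eval Σ ρ ≼ u
    premise≼u (here refl) = begin
      eval (Π ++ Δ ++ Γ) ρ  ≈⟨ eval-ex Π Γ Δ ρ ⟨
      eval (Π ++ Γ ++ Δ) ρ  ≤⟨ H≼u (Equivalence.from e (here refl)) ⟩
      u                     ∎
    premise≼u (there Σ∈G) = H≼u (Equivalence.from e (there Σ∈G))
  GA-sound (split G Γ Δ e d) ρ u H≼u = ε≼u∙[u∨ε]⇒ε≼u u (GA-sound d ρ (u ∙ (u ∨ ε)) premise≼)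
    where
    u≼u∙[u∨ε] : u ≼ u ∙ (u ∨ ε)
    u≼u∙[u∨ε] = begin
      u      ≈⟨ identityʳ u ⟨
      u ∙ ε  ≤⟨ ∙-monoʳ-≼ u (y≤x∨y u ε) ⟩
      u ∙ (u ∨ ε) ∎
    premise≼ : ∀ {Σ} → Σ ∈ (Γ ++ Δ) ∷ G → eval Σ ρ ≼ u ∙ (u ∨ ε)
    premise≼ (here refl) = begin
      eval (Γ ++ Δ) ρ     ≈⟨ eval-++ Γ Δ ρ ⟩
      eval Γ ρ ∙ eval Δ ρ ≤⟨ ∙-mono-≼ (H≼u (Equivalence.from e (here refl)))
                                      (≼-trans (H≼u (Equivalence.from e (there (here refl)))) (x≤x∨y u ε)) ⟩
      u ∙ (u ∨ ε)         ∎
    premise≼ (there Σ∈G) = ≼-trans (H≼u (Equivalence.from e (there (there Σ∈G)))) u≼u∙[u∨ε]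

  eval≼⟦⟧h : ∀ Γ Gs ρ {Σ} → Σ ∈ Γ ∷ Gs → eval Σ ρ ≼ ⟦_∷_⟧h L Γ Gs ρ
  eval≼⟦⟧h Γ []       ρ (here refl) = ≼-reflexive (≈-sym (⟦⟧s≈eval Γ ρ))
  eval≼⟦⟧h Γ (Δ ∷ Gs) ρ (here refl) = begin
    eval Γ ρ                      ≈⟨ ⟦⟧s≈eval Γ ρ ⟨
    ⟦_⟧s L Γ ρ                    ≤⟨ x≤x∨y _ _ ⟩
    ⟦_∷_⟧h L Γ (Δ ∷ Gs) ρ         ∎
  eval≼⟦⟧h Γ (Δ ∷ Gs) ρ {Σ} (there Σ∈) = begin
    eval Σ ρ                      ≤⟨ eval≼⟦⟧h Δ Gs ρ Σ∈ ⟩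
    ⟦_∷_⟧h L Δ Gs ρ               ≤⟨ y≤x∨y _ _ ⟩
    ⟦_∷_⟧h L Γ (Δ ∷ Gs) ρ         ∎

  GA-valid : ∀ Γ Gs → GA⊢ (Γ ∷ Gs) → ValidIn L Γ Gs
  GA-valid Γ Gs d ρ = ≼⇒≤ (GA-sound d ρ _ (eval≼⟦⟧h Γ Gs ρ))
ℚ-abelianLGroup : AbelianLGroup 0ℓ 0ℓ
ℚ-abelianLGroup = record
  { isAbelianGroup = +-0-isAbelianGroup
  ; isLattice      = ⊔-⊓-isLattice
  ; monotone       = λ x y a⊓b≡a → p≤q⇒p⊓q≡p (+-monoˡ-≤ y (+-monoʳ-≤ x (p⊓q≡p⇒p≤q a⊓b≡a)))
  }

open Soundness ℚ-abelianLGroup using (eval; eval-++; ⟦⟧s≈eval)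

+-cancelʳ-≡ : ∀ c {a b} → a + c ≡ b + c → a ≡ b
+-cancelʳ-≡ c = ∙-cancelʳ +-0-group c _ _

toℚ : ℕ → ℚ
toℚ zero    = 0ℚ
toℚ (suc n) = 1ℚ + toℚ n

toℚ-+ : ∀ m n → toℚ (m ℕ.+ n) ≡ toℚ m + toℚ n
toℚ-+ zero    n = sym (+-identityˡ (toℚ n))
toℚ-+ (suc m) n = trans (cong (1ℚ +_) (toℚ-+ m n)) (sym (+-assoc 1ℚ (toℚ m) (toℚ n)))

0≤toℚ : ∀ n → 0ℚ ≤ toℚ n
0≤toℚ zero    = ≤-refl
0≤toℚ (suc n) = subst (_≤ toℚ (suc n)) (+-identityʳ 0ℚ) (+-mono-≤ (<⇒≤ (positive⁻¹ 1ℚ)) (0≤toℚ n))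

0<toℚ-suc : ∀ n → 0ℚ < toℚ (suc n)
0<toℚ-suc n = subst (_< toℚ (suc n)) (+-identityʳ 0ℚ) (+-mono-<-≤ (positive⁻¹ 1ℚ) (0≤toℚ n))

toℚ-suc-positive : ∀ n → Positive (toℚ (suc n))
toℚ-suc-positive n = positive (0<toℚ-suc n)

toℚ-suc-nonZero : ∀ n → NonZero (toℚ (suc n))
toℚ-suc-nonZero n = pos⇒nonZero (toℚ (suc n)) {{toℚ-suc-positive n}}

infixl 7 _/[1+_]
_/[1+_] : ℚ → ℕ → ℚ
q /[1+ n ] = (q ÷ toℚ (suc n)) {{toℚ-suc-nonZero n}}

*-/[1+]-cancel : ∀ n q → toℚ (suc n) * (q /[1+ n ]) ≡ q
*-/[1+]-cancel n q = begin
  k * (q * k⁻¹)   ≡⟨ solve 3 (λ k q i → k :* (q :* i) := q :* (k :* i)) refl k q k⁻¹ ⟩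
  q * (k * k⁻¹)   ≡⟨ cong (q *_) (*-inverseʳ k {{toℚ-suc-nonZero n}}) ⟩
  q * 1ℚ          ≡⟨ *-identityʳ q ⟩
  q               ∎
  where
  open ≡-Reasoning
  open ℚ-Solver
  k k⁻¹ : ℚ
  k = toℚ (suc n)
  k⁻¹ = (1/ k) {{toℚ-suc-nonZero n}}

<-/[1+]⇒ : ∀ n {c t} → t < (- c) /[1+ n ] → c + toℚ (suc n) * t < 0ℚ
<-/[1+]⇒ n {c} {t} t<bound = begin-strict
  c + k * t                 <⟨ +-monoʳ-< c (*-monoʳ-<-pos k {{toℚ-suc-positive n}} t<bound) ⟩
  c + k * ((- c) /[1+ n ])  ≡⟨ cong (c +_) (*-/[1+]-cancel n (- c)) ⟩
  c + - c                   ≡⟨ +-inverseʳ c ⟩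
  0ℚ                        ∎
  where
  open ≤-Reasoning
  k : ℚ
  k = toℚ (suc n)

/[1+]<⇒ : ∀ n {c t} → c /[1+ n ] < t → c - toℚ (suc n) * t < 0ℚ
/[1+]<⇒ n {c} {t} bound<t = begin-strict
  c - k * t                  ≡⟨ cong (_- k * t) (*-/[1+]-cancel n c) ⟨
  k * (c /[1+ n ]) - k * t   <⟨ +-monoˡ-< (- (k * t)) (*-monoʳ-<-pos k {{toℚ-suc-positive n}} bound<t) ⟩
  k * t - k * t              ≡⟨ +-inverseʳ (k * t) ⟩
  0ℚ                         ∎
  where
  open ≤-Reasoning
  k : ℚ
  k = toℚ (suc n)

/[1+]<-cross : ∀ m n {c d} → toℚ (suc m) * c + toℚ (suc n) * d < 0ℚ → d /[1+ m ] < (- c) /[1+ n ]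
/[1+]<-cross m n {c} {d} hyp = *-cancelˡ-<-nonNeg k {{k≥0}} (begin-strict
  k * (d /[1+ m ])          ≡⟨ solve 3 (λ a b x → (a :* b) :* x := b :* (a :* x)) refl m′ n′ (d /[1+ m ]) ⟩
  n′ * (m′ * (d /[1+ m ]))  ≡⟨ cong (n′ *_) (*-/[1+]-cancel m d) ⟩
  n′ * d                    ≡⟨ solve 4 (λ a b c d → b :* d := (a :* c :+ b :* d) :+ (:- (a :* c))) refl m′ n′ c d ⟩
  (m′ * c + n′ * d) + - (m′ * c)  <⟨ +-monoˡ-< (- (m′ * c)) hyp ⟩
  0ℚ + - (m′ * c)           ≡⟨ solve 2 (λ a c → con 0ℚ :+ (:- (a :* c)) := a :* (:- c)) refl m′ c ⟩
  m′ * (- c)                ≡⟨ cong (m′ *_) (*-/[1+]-cancel n (- c)) ⟨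
  m′ * (n′ * ((- c) /[1+ n ])) ≡⟨ solve 3 (λ a b x → a :* (b :* x) := (a :* b) :* x) refl m′ n′ ((- c) /[1+ n ]) ⟩
  k * ((- c) /[1+ n ])      ∎)
  where
  open ≤-Reasoning
  open ℚ-Solver
  m′ n′ k : ℚ
  m′ = toℚ (suc m)
  n′ = toℚ (suc n)
  k = m′ * n′
  k≥0 : NonNegative k
  k≥0 = pos⇒nonNeg k {{pos*pos⇒pos m′ {{toℚ-suc-positive m}} n′ {{toℚ-suc-positive n}}}}

exists-above : ∀ {m} us → All (m <_) us → ∃ λ t → m < t × All (t <_) us
exists-above {m} [] [] = m + 1ℚ , subst (_< m + 1ℚ) (+-identityʳ m) (+-monoʳ-< m (positive⁻¹ 1ℚ)) , []
exists-above (u ∷ us) (m<u ∷ m<us) with exists-above us m<us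
... | t , m<t , t<us with t <? u
...   | yes t<u = t , m<t , t<u ∷ t<us
...   | no  t≮u with <-dense m<u
...     | s , m<s , s<u = s , m<s , s<u ∷ All.map (<-trans (<-≤-trans s<u (≮⇒≥ t≮u))) t<us

exists-below : ∀ us → ∃ λ t → All (t <_) us
exists-below [] = 0ℚ , []
exists-below (u ∷ us) with exists-below us
... | t , t<us with t <? u
...   | yes t<u = t , t<u ∷ t<us
...   | no  t≮u = u - 1ℚ , u-1<u ∷ All.map (<-trans (<-≤-trans u-1<u (≮⇒≥ t≮u))) t<us
  where
  u-1<u : u - 1ℚ < u
  u-1<u = subst (u - 1ℚ <_) (+-identityʳ u) (+-monoʳ-< u (negative⁻¹ (- 1ℚ)))

interpolate : ∀ ls us → All (λ l → All (l <_) us) ls → ∃ λ t → All (_< t) ls × All (t <_) us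
interpolate [] us [] with exists-below us
... | t , t<us = t , [] , t<us
interpolate (l ∷ ls) us (l<us ∷ ls<us) with interpolate ls us ls<us
... | t , ls<t , t<us with l <? t
...   | yes l<t = t , l<t ∷ ls<t , t<us
...   | no  l≮t with exists-above us l<us
...     | s , l<s , s<us = s , l<s ∷ All.map (λ k<t → <-trans k<t (≤-<-trans (≮⇒≥ l≮t) l<s)) ls<t , s<us

_[_↦_] : ∀ {A : Set} → (Var → A) → Var → A → Var → A
(ρ [ x ↦ t ]) y with x ℕₚ.≟ y
... | yes _ = t
... | no  _ = ρ y

[↦]-self : ∀ {A : Set} (ρ : Var → A) x y → (ρ [ x ↦ ρ x ]) y ≡ ρ y
[↦]-self ρ x y with x ℕₚ.≟ y
... | yes refl = refl
... | no  _    = refl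

eval-ext : ∀ Γ {ρ σ} → (∀ y → ρ y ≡ σ y) → eval Γ ρ ≡ eval Γ σ
eval-ext []          ρ≗σ = refl
eval-ext (pos z ∷ Γ) ρ≗σ = cong₂ _+_ (ρ≗σ z) (eval-ext Γ ρ≗σ)
eval-ext (neg z ∷ Γ) ρ≗σ = cong₂ _+_ (cong -_ (ρ≗σ z)) (eval-ext Γ ρ≗σ)

⟦_⟧ℚ : Literal → (Var → ℚ) → ℚ
⟦ l ⟧ℚ = ⟦_⟧ℓ ℚ-abelianLGroup l

literal-[↦] : ∀ x l ρ t →
  ⟦ l ⟧ℚ (ρ [ x ↦ t ]) + toℚ (δ (neg x) l) * t ≡ ⟦ l ⟧ℚ (ρ [ x ↦ 0ℚ ]) + toℚ (δ (pos x) l) * t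
literal-[↦] x (pos z) ρ t with x ℕₚ.≟ z
... | yes refl = trans (solve 1 (λ t → t :+ con 0ℚ :* t := con 0ℚ :+ (con 1ℚ :+ con 0ℚ) :* t) refl t)
                       (cong (λ k → 0ℚ + toℚ k * t) (sym (δ-refl (pos x))))
  where open ℚ-Solver
... | no  x≢z  = cong (λ k → ρ z + toℚ k * t) (sym (δ-≢ (x≢z ∘ pos-injective)))
literal-[↦] x (neg z) ρ t with x ℕₚ.≟ z
... | yes refl = trans (cong (λ k → - t + toℚ k * t) (δ-refl (neg x)))
                       (solve 1 (λ t → :- t :+ (con 1ℚ :+ con 0ℚ) :* t := :- con 0ℚ :+ con 0ℚ :* t) refl t)
  where open ℚ-Solver
... | no  x≢z  = cong (λ k → - ρ z + toℚ k * t) (δ-≢ (x≢z ∘ neg-injective))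

eval-[↦] : ∀ x Γ ρ t →
  eval Γ (ρ [ x ↦ t ]) + toℚ (count (neg x) Γ) * t ≡ eval Γ (ρ [ x ↦ 0ℚ ]) + toℚ (count (pos x) Γ) * t
eval-[↦] x []      ρ t = refl
eval-[↦] x (l ∷ Γ) ρ t
  rewrite toℚ-+ (δ (neg x) l) (count (neg x) Γ) | toℚ-+ (δ (pos x) l) (count (pos x) Γ) = begin
  (a₁ + e₁) + (d₁ + n) * t      ≡⟨ regroup a₁ e₁ d₁ n ⟩
  (a₁ + d₁ * t) + (e₁ + n * t)  ≡⟨ cong₂ _+_ (literal-[↦] x l ρ t) (eval-[↦] x Γ ρ t) ⟩
  (a₀ + d₀ * t) + (e₀ + p * t)  ≡⟨ regroup a₀ e₀ d₀ p ⟨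
  (a₀ + e₀) + (d₀ + p) * t      ∎
  where
  open ≡-Reasoning
  a₁ a₀ e₁ e₀ d₁ d₀ n p : ℚ
  a₁ = ⟦ l ⟧ℚ (ρ [ x ↦ t ])
  a₀ = ⟦ l ⟧ℚ (ρ [ x ↦ 0ℚ ])
  e₁ = eval Γ (ρ [ x ↦ t ])
  e₀ = eval Γ (ρ [ x ↦ 0ℚ ])
  d₁ = toℚ (δ (neg x) l)
  d₀ = toℚ (δ (pos x) l)
  n = toℚ (count (neg x) Γ)
  p = toℚ (count (pos x) Γ)
  regroup : ∀ a e d k → (a + e) + (d + k) * t ≡ (a + d * t) + (e + k * t)
  regroup a e d k =
    solve 5 (λ a e d k t → (a :+ e) :+ (d :+ k) :* t := (a :+ d :* t) :+ (e :+ k :* t)) refl a e d k t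
    where open ℚ-Solver

eval-^ : ∀ Γ n ρ → eval (Γ ^ n) ρ ≡ toℚ n * eval Γ ρ
eval-^ Γ zero    ρ = sym (*-zeroˡ (eval Γ ρ))
eval-^ Γ (suc n) ρ = begin
  eval (Γ ++ Γ ^ n) ρ         ≡⟨ eval-++ Γ (Γ ^ n) ρ ⟩
  eval Γ ρ + eval (Γ ^ n) ρ   ≡⟨ cong (eval Γ ρ +_) (eval-^ Γ n ρ) ⟩
  eval Γ ρ + toℚ n * eval Γ ρ ≡⟨ solve 2 (λ e k → e :+ k :* e := (con 1ℚ :+ k) :* e) refl (eval Γ ρ) (toℚ n) ⟩
  toℚ (suc n) * eval Γ ρ      ∎
  where
  open ≡-Reasoning
  open ℚ-Solver

data Excess (m n : ℕ) : Set where
  balanced : m ≡ n → Excess m n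
  surplus  : ∀ a → m ≡ suc (n ℕ.+ a) → Excess m n
  deficit  : ∀ b → n ≡ suc (m ℕ.+ b) → Excess m n

excess : ∀ m n → Excess m n
excess m n with ℕ.compare m n
... | ℕ.less    m k = deficit k refl
... | ℕ.equal   m   = balanced refl
... | ℕ.greater n k = surplus k refl

Refutes : (Var → ℚ) → Hypersequent → Set
Refutes ρ H = All (λ Γ → eval Γ ρ < 0ℚ) H

module _ (x : Var) where

  excessIn : ∀ Γ → Excess (count (pos x) Γ) (count (neg x) Γ)
  excessIn Γ = excess (count (pos x) Γ) (count (neg x) Γ)

  keepIfBalanced : Sequent → Hypersequent
  keepIfBalanced Γ with excessIn Γ
  ... | balanced _ = [ Γ ]
  ... | _          = []

  combine : Sequent → Sequent → Hypersequent
  combine Γ Δ with excessIn Γ | excessIn Δ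
  ... | surplus a _ | deficit b _ = [ Γ ^ suc b ++ Δ ^ suc a ]
  ... | _           | _           = []

  eliminate : Hypersequent → Hypersequent
  eliminate H = concatMap keepIfBalanced H ++ concatMap (λ Γ → concatMap (combine Γ) H) H

  data Eliminant (H : Hypersequent) : Sequent → Set where
    kept     : ∀ {Γ} → Γ ∈ H → BalancedIn x Γ → Eliminant H Γ
    combined : ∀ {Γ Δ a b} → Γ ∈ H → Δ ∈ H →
               count (pos x) Γ ≡ suc (count (neg x) Γ ℕ.+ a) →
               count (neg x) Δ ≡ suc (count (pos x) Δ ℕ.+ b) →
               Eliminant H (Γ ^ suc b ++ Δ ^ suc a)

  ∈-eliminate⁻ : ∀ {H Σ} → Σ ∈ eliminate H → Eliminant H Σ
  ∈-eliminate⁻ {H} Σ∈ with ∈-++⁻ (concatMap keepIfBalanced H) Σ∈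
  ... | inj₁ Σ∈kept with find (∈-concatMap⁻ keepIfBalanced Σ∈kept)
  ...   | Γ , Γ∈H , Σ∈keep = from-keep Γ∈H Σ∈keep
    where
    from-keep : ∀ {Γ Σ} → Γ ∈ H → Σ ∈ keepIfBalanced Γ → Eliminant H Σ
    from-keep {Γ} Γ∈H Σ∈keep with excessIn Γ
    from-keep Γ∈H (here refl) | balanced e = kept Γ∈H e
  ∈-eliminate⁻ {H} Σ∈ | inj₂ Σ∈comb with find (∈-concatMap⁻ (λ Γ → concatMap (combine Γ) H) Σ∈comb)
  ...   | Γ , Γ∈H , Σ∈combΓ with find (∈-concatMap⁻ (combine Γ) Σ∈combΓ)
  ...     | Δ , Δ∈H , Σ∈combΓΔ = from-combine Γ∈H Δ∈H Σ∈combΓΔ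
    where
    from-combine : ∀ {Γ Δ Σ} → Γ ∈ H → Δ ∈ H → Σ ∈ combine Γ Δ → Eliminant H Σ
    from-combine {Γ} {Δ} Γ∈H Δ∈H Σ∈ with excessIn Γ | excessIn Δ
    from-combine Γ∈H Δ∈H (here refl) | surplus a p | deficit b q = combined Γ∈H Δ∈H p q
    from-combine Γ∈H Δ∈H ()          | balanced _  | _
    from-combine Γ∈H Δ∈H ()          | deficit _ _ | _
    from-combine Γ∈H Δ∈H ()          | surplus _ _ | balanced _
    from-combine Γ∈H Δ∈H ()          | surplus _ _ | surplus _ _

  ∈-eliminate⁺-kept : ∀ {H Γ e} → Γ ∈ H → excessIn Γ ≡ balanced e → Γ ∈ eliminate H
  ∈-eliminate⁺-kept {H} {Γ} Γ∈H eq = ∈-++⁺ˡ (∈-concatMap⁺ keepIfBalanced (lose Γ∈H Γ∈keep))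
    where
    Γ∈keep : Γ ∈ keepIfBalanced Γ
    Γ∈keep rewrite eq = here refl

  ∈-eliminate⁺-combined : ∀ {H Γ Δ a b p q} → Γ ∈ H → Δ ∈ H →
    excessIn Γ ≡ surplus a p → excessIn Δ ≡ deficit b q → Γ ^ suc b ++ Δ ^ suc a ∈ eliminate H
  ∈-eliminate⁺-combined {H} {Γ} {Δ} {a} {b} Γ∈H Δ∈H eqΓ eqΔ =
    ∈-++⁺ʳ (concatMap keepIfBalanced H)
      (∈-concatMap⁺ (λ Γ → concatMap (combine Γ) H) (lose Γ∈H (∈-concatMap⁺ (combine Γ) (lose Δ∈H ∈combine))))
    where
    ∈combine : Γ ^ suc b ++ Δ ^ suc a ∈ combine Γ Δ
    ∈combine rewrite eqΓ | eqΔ = here refl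

  eval-balanced : ∀ {Γ} ρ t → BalancedIn x Γ → eval Γ (ρ [ x ↦ t ]) ≡ eval Γ (ρ [ x ↦ 0ℚ ])
  eval-balanced {Γ} ρ t bal = +-cancelʳ-≡ (toℚ (count (neg x) Γ) * t)
    (trans (eval-[↦] x Γ ρ t) (cong (λ k → eval Γ (ρ [ x ↦ 0ℚ ]) + toℚ k * t) bal))

  eval-balanced-here : ∀ {Γ} ρ → BalancedIn x Γ → eval Γ ρ ≡ eval Γ (ρ [ x ↦ 0ℚ ])
  eval-balanced-here {Γ} ρ bal =
    trans (eval-ext Γ (λ y → sym ([↦]-self ρ x y))) (eval-balanced {Γ} ρ (ρ x) bal)

  eval-surplus : ∀ {Γ a} ρ t → count (pos x) Γ ≡ suc (count (neg x) Γ ℕ.+ a) →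
                 eval Γ (ρ [ x ↦ t ]) ≡ eval Γ (ρ [ x ↦ 0ℚ ]) + toℚ (suc a) * t
  eval-surplus {Γ} {a} ρ t p = +-cancelʳ-≡ (N * t) (begin
    eval Γ (ρ [ x ↦ t ]) + N * t    ≡⟨ eval-[↦] x Γ ρ t ⟩
    e₀ + toℚ (count (pos x) Γ) * t  ≡⟨ cong (λ k → e₀ + toℚ k * t) p ⟩
    e₀ + (1ℚ + toℚ (n ℕ.+ a)) * t   ≡⟨ cong (λ k → e₀ + (1ℚ + k) * t) (toℚ-+ n a) ⟩
    e₀ + (1ℚ + (N + A)) * t         ≡⟨ solve 4 (λ e n a t → e :+ (con 1ℚ :+ (n :+ a)) :* t
                                                    := (e :+ (con 1ℚ :+ a) :* t) :+ n :* t) refl e₀ N A t ⟩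
    e₀ + toℚ (suc a) * t + N * t    ∎)
    where
    open ≡-Reasoning
    open ℚ-Solver
    e₀ : ℚ
    e₀ = eval Γ (ρ [ x ↦ 0ℚ ])
    n : ℕ
    n = count (neg x) Γ
    N A : ℚ
    N = toℚ n
    A = toℚ a

  eval-deficit : ∀ {Γ b} ρ t → count (neg x) Γ ≡ suc (count (pos x) Γ ℕ.+ b) →
                 eval Γ (ρ [ x ↦ t ]) ≡ eval Γ (ρ [ x ↦ 0ℚ ]) - toℚ (suc b) * t
  eval-deficit {Γ} {b} ρ t q = +-cancelʳ-≡ (toℚ (count (neg x) Γ) * t) (begin
    eval Γ (ρ [ x ↦ t ]) + toℚ (count (neg x) Γ) * t  ≡⟨ eval-[↦] x Γ ρ t ⟩
    e₀ + P * t                                        ≡⟨ solve 4 (λ e p b t → e :+ p :* t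
                                                           := (e :- (con 1ℚ :+ b) :* t) :+ (con 1ℚ :+ (p :+ b)) :* t)
                                                           refl e₀ P B t ⟩
    e₀ - B′ * t + (1ℚ + (P + B)) * t                  ≡⟨ cong (λ k → e₀ - B′ * t + (1ℚ + k) * t) (toℚ-+ p b) ⟨
    e₀ - B′ * t + toℚ (suc (p ℕ.+ b)) * t             ≡⟨ cong (λ k → e₀ - B′ * t + toℚ k * t) q ⟨
    e₀ - B′ * t + toℚ (count (neg x) Γ) * t           ∎)
    where
    open ≡-Reasoning
    open ℚ-Solver
    e₀ : ℚ
    e₀ = eval Γ (ρ [ x ↦ 0ℚ ])
    p : ℕ
    p = count (pos x) Γ
    P B B′ : ℚ
    P = toℚ p
    B = toℚ b
    B′ = toℚ (suc b)

  combination-balanced : ∀ {Γ Δ a b} →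
    count (pos x) Γ ≡ suc (count (neg x) Γ ℕ.+ a) → count (neg x) Δ ≡ suc (count (pos x) Δ ℕ.+ b) →
    BalancedIn x (Γ ^ suc b ++ Δ ^ suc a)
  combination-balanced {Γ} {Δ} {a} {b} p q
    rewrite count-++ (pos x) (Γ ^ suc b) (Δ ^ suc a) | count-++ (neg x) (Γ ^ suc b) (Δ ^ suc a)
          | count-^ (pos x) Γ (suc b) | count-^ (pos x) Δ (suc a)
          | count-^ (neg x) Γ (suc b) | count-^ (neg x) Δ (suc a) | p | q =
    solve 4 (λ a b n p → (con 1 :+ b) :* (con 1 :+ (n :+ a)) :+ (con 1 :+ a) :* p
                      := (con 1 :+ b) :* n :+ (con 1 :+ a) :* (con 1 :+ (p :+ b)))
      refl a b (count (neg x) Γ) (count (pos x) Δ)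
    where open ℕ-Solver

  eliminant-balanced : ∀ {H Σ} → Eliminant H Σ → BalancedIn x Σ
  eliminant-balanced (kept _ bal)         = bal
  eliminant-balanced (combined {Γ} {Δ} {a} {b} _ _ p q) = combination-balanced {Γ} {Δ} {a} {b} p q

  eliminant-balancedIn : ∀ {H Σ} y → (∀ {Γ} → Γ ∈ H → BalancedIn y Γ) → Eliminant H Σ → BalancedIn y Σ
  eliminant-balancedIn y H-bal (kept Γ∈H _) = H-bal Γ∈H
  eliminant-balancedIn y H-bal (combined {Γ} {Δ} {a} {b} Γ∈H Δ∈H _ _)
    rewrite count-++ (pos y) (Γ ^ suc b) (Δ ^ suc a) | count-++ (neg y) (Γ ^ suc b) (Δ ^ suc a)
          | count-^ (pos y) Γ (suc b) | count-^ (pos y) Δ (suc a)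
          | count-^ (neg y) Γ (suc b) | count-^ (neg y) Δ (suc a)
          | H-bal Γ∈H | H-bal Δ∈H = refl

  GA-absorb-eliminant : ∀ {H K Σ} → (∀ {Γ} → Γ ∈ H → Γ ∈ K) → Eliminant H Σ → GA⊢ (Σ ∷ K) → GA⊢ K
  GA-absorb-eliminant H⊆K (kept Γ∈H _) = GA-contract (H⊆K Γ∈H)
  GA-absorb-eliminant H⊆K (combined {a = a} {b} Γ∈H Δ∈H _ _) =
    GA-absorb-^-suc a (H⊆K Δ∈H) ∘ GA-absorb-^ (suc b) (H⊆K Γ∈H)

  GA-eliminate : ∀ {H} → GA⊢ (eliminate H) → GA⊢ H
  GA-eliminate {H} d = absorb-all (eliminate H) (λ Σ∈ → Σ∈) (GA-weaken H d)
    where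
    absorb-all : ∀ Σs → (∀ {Σ} → Σ ∈ Σs → Σ ∈ eliminate H) → GA⊢ (Σs ++ H) → GA⊢ H
    absorb-all []       _   d = d
    absorb-all (Σ ∷ Σs) sub d =
      absorb-all Σs (sub ∘ there) (GA-absorb-eliminant (∈-++⁺ʳ Σs) (∈-eliminate⁻ (sub (here refl))) d)

  module Bounds (ρ : Var → ℚ) (H : Hypersequent) (refuted : Refutes ρ (eliminate H)) where

    value : Sequent → ℚ
    value Γ = eval Γ (ρ [ x ↦ 0ℚ ])

    -- ρ [ x ↦ t ] refutes a sequent with a deficit (surplus) of x exactly when t lies
    -- above its lower (below its upper) bound.
    lowerBound : Sequent → List ℚ
    lowerBound Γ with excessIn Γ
    ... | deficit b _ = [ value Γ /[1+ b ] ]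
    ... | _           = []

    upperBound : Sequent → List ℚ
    upperBound Γ with excessIn Γ
    ... | surplus a _ = [ (- value Γ) /[1+ a ] ]
    ... | _           = []

    ∈-lowerBound : ∀ {Γ b q} → excessIn Γ ≡ deficit b q → value Γ /[1+ b ] ∈ lowerBound Γ
    ∈-lowerBound eq rewrite eq = here refl

    ∈-upperBound : ∀ {Γ a p} → excessIn Γ ≡ surplus a p → (- value Γ) /[1+ a ] ∈ upperBound Γ
    ∈-upperBound eq rewrite eq = here refl

    combination-negative : ∀ {Γ Δ a b p q} → Γ ∈ H → Δ ∈ H →
      excessIn Γ ≡ surplus a p → excessIn Δ ≡ deficit b q → toℚ (suc b) * value Γ + toℚ (suc a) * value Δ < 0ℚ
    combination-negative {Γ} {Δ} {a} {b} {p} {q} Γ∈H Δ∈H eqΓ eqΔ =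
      subst (_< 0ℚ) value-combination (All.lookup refuted (∈-eliminate⁺-combined Γ∈H Δ∈H eqΓ eqΔ))
      where
      open ≡-Reasoning
      ρ₀ : Var → ℚ
      ρ₀ = ρ [ x ↦ 0ℚ ]
      Σ : Sequent
      Σ = Γ ^ suc b ++ Δ ^ suc a
      value-combination : eval Σ ρ ≡ toℚ (suc b) * value Γ + toℚ (suc a) * value Δ
      value-combination = begin
        eval Σ ρ                                   ≡⟨ eval-balanced-here {Σ} ρ (combination-balanced {Γ} {Δ} {a} {b} p q) ⟩
        eval Σ ρ₀                                  ≡⟨ eval-++ (Γ ^ suc b) (Δ ^ suc a) ρ₀ ⟩
        eval (Γ ^ suc b) ρ₀ + eval (Δ ^ suc a) ρ₀  ≡⟨ cong₂ _+_ (eval-^ Γ (suc b) ρ₀) (eval-^ Δ (suc a) ρ₀) ⟩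
        toℚ (suc b) * value Γ + toℚ (suc a) * value Δ ∎

    lowers<uppers : All (λ l → All (l <_) (concatMap upperBound H)) (concatMap lowerBound H)
    lowers<uppers = concat⁺ (map⁺ (All.tabulate below-uppers))
      where
      below-upper : ∀ {Δ b q Γ} → Δ ∈ H → excessIn Δ ≡ deficit b q → Γ ∈ H →
                    All (value Δ /[1+ b ] <_) (upperBound Γ)
      below-upper {Δ} {b} {Γ = Γ} Δ∈H eqΔ Γ∈H with excessIn Γ in eqΓ
      ... | surplus a p = /[1+]<-cross b a {value Γ} {value Δ} (combination-negative Γ∈H Δ∈H eqΓ eqΔ) ∷ []
      ... | balanced _  = []
      ... | deficit _ _ = []
      below-uppers : ∀ {Δ} → Δ ∈ H → All (λ l → All (l <_) (concatMap upperBound H)) (lowerBound Δ)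
      below-uppers {Δ} Δ∈H with excessIn Δ in eqΔ
      ... | deficit b q = concat⁺ (map⁺ (All.tabulate (below-upper Δ∈H eqΔ))) ∷ []
      ... | balanced _  = []
      ... | surplus _ _ = []

    refuted-at : ∀ t → All (_< t) (concatMap lowerBound H) → All (t <_) (concatMap upperBound H) →
                 ∀ {Γ} → Γ ∈ H → eval Γ (ρ [ x ↦ t ]) < 0ℚ
    refuted-at t lowers<t t<uppers {Γ} Γ∈H with excessIn Γ in eqΓ
    ... | balanced bal = subst (_< 0ℚ) (trans (eval-balanced-here {Γ} ρ bal) (sym (eval-balanced {Γ} ρ t bal)))
                           (All.lookup refuted (∈-eliminate⁺-kept Γ∈H eqΓ))
    ... | surplus a p = subst (_< 0ℚ) (sym (eval-surplus {Γ} ρ t p)) (<-/[1+]⇒ a {value Γ}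
                          (All.lookup t<uppers (∈-concatMap⁺ upperBound (lose Γ∈H (∈-upperBound eqΓ)))))
    ... | deficit b q = subst (_< 0ℚ) (sym (eval-deficit {Γ} ρ t q)) (/[1+]<⇒ b {value Γ}
                          (All.lookup lowers<t (∈-concatMap⁺ lowerBound (lose Γ∈H (∈-lowerBound eqΓ)))))

  refutation-lifts : ∀ {ρ H} → Refutes ρ (eliminate H) → ∃ λ t → Refutes (ρ [ x ↦ t ]) H
  refutation-lifts {ρ} {H} refuted with interpolate _ _ lowers<uppers
    where open Bounds ρ H refuted
  ... | t , lowers<t , t<uppers = t , All.tabulate (refuted-at t lowers<t t<uppers)
    where open Bounds ρ H refuted
Unrefutable : Hypersequent → Set
Unrefutable H = ∀ ρ → ¬ Refutes ρ H

BalancedFrom : ℕ → Hypersequent → Set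
BalancedFrom n H = ∀ {Γ} → Γ ∈ H → ∀ y → n ℕ.≤ y → BalancedIn y Γ

eliminate-balancedFrom : ∀ x {H} → BalancedFrom (suc x) H → BalancedFrom x (eliminate x H)
eliminate-balancedFrom x {H} H-bal Σ∈ y x≤y with ℕₚ.m≤n⇒m<n∨m≡n x≤y
... | inj₁ x<y  = eliminant-balancedIn x y (λ Γ∈H → H-bal Γ∈H y x<y) (∈-eliminate⁻ x {H} Σ∈)
... | inj₂ refl = eliminant-balanced x (∈-eliminate⁻ x {H} Σ∈)

eliminate-unrefutable : ∀ x {H} → Unrefutable H → Unrefutable (eliminate x H)
eliminate-unrefutable x {H} unref ρ refuted with refutation-lifts x {ρ} {H} refuted
... | t , refuted′ = unref (ρ [ x ↦ t ]) refuted′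

GA-complete-from : ∀ n {H} → BalancedFrom n H → Unrefutable H → GA⊢ H
GA-complete-from zero    {[]}    _     unref = ⊥-elim (unref (λ _ → 0ℚ) [])
GA-complete-from zero    {Γ ∷ H} H-bal _     = GA-balanced (λ y → H-bal (here refl) y ℕ.z≤n)
GA-complete-from (suc x) {H} H-bal unref =
  GA-eliminate x {H} (GA-complete-from x (eliminate-balancedFrom x H-bal) (eliminate-unrefutable x unref))

var : Literal → Var
var (pos y) = y
var (neg y) = y

varBound : Sequent → ℕ
varBound []      = 0
varBound (l ∷ Γ) = suc (var l) ℕ.⊔ varBound Γ

varBoundH : Hypersequent → ℕ
varBoundH []      = 0
varBoundH (Γ ∷ H) = varBound Γ ℕ.⊔ varBoundH H

count-beyond-varBound : ∀ Γ l → varBound Γ ℕ.≤ var l → count l Γ ≡ 0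
count-beyond-varBound []      l _   = refl
count-beyond-varBound (m ∷ Γ) l bnd
  rewrite δ-≢ (λ (l≡m : l ≡ m) → ℕₚ.<-irrefl (cong var (sym l≡m)) (ℕₚ.m⊔n≤o⇒m≤o (suc (var m)) (varBound Γ) bnd))
        | count-beyond-varBound Γ l (ℕₚ.m⊔n≤o⇒n≤o (suc (var m)) (varBound Γ) bnd) = refl

balancedFrom-varBoundH : ∀ H → BalancedFrom (varBoundH H) H
balancedFrom-varBoundH (Γ ∷ H) (here refl) y bnd =
  trans (count-beyond-varBound Γ (pos y) Γ-bnd) (sym (count-beyond-varBound Γ (neg y) Γ-bnd))
  where
  Γ-bnd : varBound Γ ℕ.≤ y
  Γ-bnd = ℕₚ.m⊔n≤o⇒m≤o (varBound Γ) (varBoundH H) bnd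
balancedFrom-varBoundH (Γ ∷ H) (there Σ∈H) y bnd =
  balancedFrom-varBoundH H Σ∈H y (ℕₚ.m⊔n≤o⇒n≤o (varBound Γ) (varBoundH H) bnd)

GA-complete : ∀ {H} → Unrefutable H → GA⊢ H
GA-complete {H} = GA-complete-from (varBoundH H) (balancedFrom-varBoundH H)

⟦⟧h<0 : ∀ Γ Gs ρ → Refutes ρ (Γ ∷ Gs) → ⟦_∷_⟧h ℚ-abelianLGroup Γ Gs ρ < 0ℚ
⟦⟧h<0 Γ []       ρ (Γ<0 ∷ []) = subst (_< 0ℚ) (sym (⟦⟧s≈eval Γ ρ)) Γ<0
⟦⟧h<0 Γ (Δ ∷ Gs) ρ (Γ<0 ∷ Gs<0) with ⊔-sel (⟦_⟧s ℚ-abelianLGroup Γ ρ) (⟦_∷_⟧h ℚ-abelianLGroup Δ Gs ρ)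
... | inj₁ eq = subst (_< 0ℚ) (sym (trans eq (⟦⟧s≈eval Γ ρ))) Γ<0
... | inj₂ eq = subst (_< 0ℚ) (sym eq) (⟦⟧h<0 Δ Gs ρ Gs<0)

validInℚ⇒unrefutable : ∀ Γ Gs → ValidIn ℚ-abelianLGroup Γ Gs → Unrefutable (Γ ∷ Gs)
validInℚ⇒unrefutable Γ Gs valid ρ refuted =
  <-irrefl refl (≤-<-trans (p⊓q≡p⇒p≤q (valid ρ)) (⟦⟧h<0 Γ Gs ρ refuted))

theorem3 : (Γ : Sequent) (Gs : Hypersequent) →
           Valid𝒜 Γ Gs ⇔ω GA⊢ (Γ ∷ Gs)
theorem3 Γ Gs = record
  { to   = λ valid → GA-complete (validInℚ⇒unrefutable Γ Gs (valid ℚ-abelianLGroup))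
  ; from = λ d L → Soundness.GA-valid L Γ Gs d
  }
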